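{- Suppose $\Gamma\to\Delta$ is a sequent containing only NDT formulas in normal form, and $\pi$ is an ${\mathrm{LNDT}}$ proof (respectively, a tree-like ${\mathrm{LNDT}}$ proof) of $\Gamma\to\Delta$. Then $\Gamma\to\Delta$ has an ${\mathrm{LNDT}}^{\mathrm{NF}}$ proof (respectively, a tree-like ${\mathrm{LNDT}}^{\mathrm{NF}}$ proof) $\pi'$ of size polynomially bounded by the size of $\pi$.
   Context: A literal is a propositional variable $x$ or its negation $\overline x$. DT formulas: literals, and $(ApB)$ for DT formulas $A,B$ and literal $p$ ("if $p$ is false then $A$, else $B$"). NDT formulas: literals, $(ApB)$ for NDT formulas $A,B$ and literal $p$, and $(A\lor B)$ for NDT formulas $A,B$. An NDT formula is in normal form if it has the form $\bigvee_{i<n}A_i$ (a disjunction built with binary $\lor$, arbitrarily nested) where each $A_i$ is a DT formula (i.e. $\lor$-free). Formula size = number of atomic occurrences; proof size = sum of sizes of formulas. ${\mathrm{LNDT}}$: lines are sequents $\Gamma\to\Delta$ of NDT formulas ($\Gamma,\Delta$ multisets); initial sequents $p\to p$, $p,\overline p\to$, $\to p,\overline p$; rules contraction, weakening (left and right), cut (from $\Gamma\to\Delta,A$ and $A,\Gamma\to\Delta$ infer $\Gamma\to\Delta$), dec-l (from $A,\Gamma\to\Delta,p$ and $p,B,\Gamma\to\Delta$ infer $ApB,\Gamma\to\Delta$), dec-r (from $\Gamma\to\Delta,A,p$ and $p,\Gamma\to\Delta,B$ infer $\Gamma\to\Delta,ApB$), $\lor$-l (from $A,\Gamma\to\Delta$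 and $B,\Gamma\to\Delta$ infer $A\lor B,\Gamma\to\Delta$), $\lor$-r (from $\Gamma\to\Delta,A,B$ infer $\Gamma\to\Delta,A\lor B$). Proofs are dag-like unless tree-like is specified. ${\mathrm{LNDT}}^{\mathrm{NF}}$ is ${\mathrm{LNDT}}$ restricted to proofs all of whose sequents contain only NDT formulas in normal form. -}

module Defs where

open import Data.Nat using (ℕ; zero; suc; _+_; _*_; _^_; _≤_)
open import Data.List using (List; []; _∷_; [_])
open import Data.List.Relation.Unary.All using (All; []; _∷_)
open import Data.List.Membership.Propositional using (_∈_)
open import Data.List.Relation.Binary.Pointwise using (Pointwise)
open import Data.List.Relation.Binary.Permutation.Propositional using (_↭_)
open import Data.Unit using (⊤)
open import Data.Product using (Σ; _×_; _,_; ∃; ∃-syntax)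

data Lit : Set where
  pos : ℕ → Lit
  neg : ℕ → Lit

_ᶜ : Lit → Lit
pos x ᶜ = neg x
neg x ᶜ = pos x

-- NDT formulas.  dec A p B  is  (A p B): "if p is false then A, else B".

data Fml : Set where
  lit : Lit → Fml
  dec : Fml → Lit → Fml → Fml
  _∨_ : Fml → Fml → Fml

data IsDT : Fml → Set where
  lit : ∀ p → IsDT (lit p)
  dec : ∀ {A B} p → IsDT A → IsDT B → IsDT (dec A p B)

data IsNF : Fml → Set where
  dt : ∀ {A} → IsDT A → IsNF A
  or : ∀ {A B} → IsNF A → IsNF B → IsNF (A ∨ B)

fsize : Fml → ℕ
fsize (lit p)     = 1
fsize (dec A p B) = fsize A + 1 + fsize B
fsize (A ∨ B)     = fsize A + fsize B

sumSize : List Fml → ℕ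
sumSize []       = 0
sumSize (A ∷ As) = fsize A + sumSize As

-- Sequents Γ → Δ.  Cedents are multisets, represented as lists taken
-- up to permutation.

Seq : Set
Seq = List Fml × List Fml

_≈S_ : Seq → Seq → Set
(Γ , Δ) ≈S (Γ' , Δ') = (Γ ↭ Γ') × (Δ ↭ Δ')

ssize : Seq → ℕ
ssize (Γ , Δ) = sumSize Γ + sumSize Δ

SeqNF : Seq → Set
SeqNF (Γ , Δ) = All IsNF Γ × All IsNF Δ

-- Rules of LNDT  (Inf premises conclusion), principal formulas written
-- in front; arbitrary positions are obtained via permutation in Step.

data Inf : List Seq → Seq → Set where
  ax-id  : ∀ p → Inf [] (lit p ∷ [] , lit p ∷ [])
  ax-l   : ∀ p → Inf [] (lit p ∷ lit (p ᶜ) ∷ [] , [])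
  ax-r   : ∀ p → Inf [] ([] , lit p ∷ lit (p ᶜ) ∷ [])
  contr-l : ∀ {Γ Δ A} → Inf [ (A ∷ A ∷ Γ , Δ) ] (A ∷ Γ , Δ)
  contr-r : ∀ {Γ Δ A} → Inf [ (Γ , A ∷ A ∷ Δ) ] (Γ , A ∷ Δ)
  weak-l  : ∀ {Γ Δ A} → Inf [ (Γ , Δ) ] (A ∷ Γ , Δ)
  weak-r  : ∀ {Γ Δ A} → Inf [ (Γ , Δ) ] (Γ , A ∷ Δ)
  cut     : ∀ {Γ Δ A} → Inf ((Γ , A ∷ Δ) ∷ (A ∷ Γ , Δ) ∷ []) (Γ , Δ)
  dec-l   : ∀ {Γ Δ A B p} →
            Inf ((A ∷ Γ , lit p ∷ Δ) ∷ (lit p ∷ B ∷ Γ , Δ) ∷ []) (dec A p B ∷ Γ , Δ)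
  dec-r   : ∀ {Γ Δ A B p} →
            Inf ((Γ , A ∷ lit p ∷ Δ) ∷ (lit p ∷ Γ , B ∷ Δ) ∷ []) (Γ , dec A p B ∷ Δ)
  ∨-l     : ∀ {Γ Δ A B} → Inf ((A ∷ Γ , Δ) ∷ (B ∷ Γ , Δ) ∷ []) (A ∨ B ∷ Γ , Δ)
  ∨-r     : ∀ {Γ Δ A B} → Inf [ (Γ , A ∷ B ∷ Δ) ] (Γ , A ∨ B ∷ Δ)

Step : List Seq → Seq → Set
Step ps s = Σ (List Seq) λ ps' → Σ Seq λ s' →
  Inf ps' s' × Pointwise _≈S_ ps ps' × (s ≈S s')

-- Dag-like proofs: a sequence of lines, each obtained by a rule from
-- (zero, one or two) earlier lines.  The list is stored in reverse
-- order: the head is the last line.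

data Lines : List Seq → Set where
  []  : Lines []
  _∷_ : ∀ {ls s} → (Σ (List Seq) λ ps → All (_∈ ls) ps × Step ps s) →
        Lines ls → Lines (s ∷ ls)

DagProof : Seq → List Seq → Set
DagProof s earlier = Lines (s ∷ earlier)

dagSize : List Seq → ℕ
dagSize []       = 0
dagSize (s ∷ ls) = ssize s + dagSize ls

DagNF : List Seq → Set
DagNF ls = All SeqNF ls

data Tree : Seq → Set
data Trees : List Seq → Set

data Tree where
  node : ∀ {ps s} → Step ps s → Trees ps → Tree s

data Trees where
  []  : Trees []
  _∷_ : ∀ {s ps} → Tree s → Trees ps → Trees (s ∷ ps)

treeSize : ∀ {s} → Tree s → ℕ
treesSize : ∀ {ps} → Trees ps → ℕ
treeSize {s} (node _ ts) = ssize s + treesSize ts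
treesSize [] = 0
treesSize (t ∷ ts) = treeSize t + treesSize ts

TreeNF : ∀ {s} → Tree s → Set
TreesNF : ∀ {ps} → Trees ps → Set
TreeNF {s} (node _ ts) = SeqNF s × TreesNF ts
TreesNF [] = ⊤
TreesNF (t ∷ ts) = TreeNF t × TreesNF ts

-- A formula is normalised by distributing each decision node whose branches
-- are disjunctions:  (⋁ Fᵢ) p (⋁ Gⱼ)  becomes  ⋁ (Fᵢ p p̄) ∨ ⋁ (p p Gⱼ).  This map
-- nf fixes normal forms and satisfies |nf A| ≤ |A|².  Applying nf to every line
-- of an LNDT proof keeps each inference an inference, except dec-l and dec-r on
-- a distributed formula.  With X = ⋁ (Fᵢ p p̄) and Y = ⋁ (p p Gⱼ), such a step is
-- replaced by cuts of its translated premises against the cut-free sequents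
-- X ⊢ F,  X, p ⊢,  Y ⊢ G,  Y ⊢ p  (resp. F ⊢ X, p  and  G, p ⊢ Y), which have
-- derivations with linearly many inferences.  Hence an inference with
-- conclusion s becomes O(|s|²) lines of size O(|s|²); as the dag or tree shape
-- of the proof is kept, the new proof has size O(|π|⁴).

module Submission where

open import Defs
open import Data.Nat using (ℕ; zero; suc; _+_; _*_; _^_; _≤_; z≤n; s≤s; NonZero)
open import Data.Nat.Properties
open import Data.Nat.ListAction using (sum)
open import Data.Nat.ListAction.Properties using (sum-↭)
open import Data.Nat.Tactic.RingSolver using (solve-∀)
open import Data.List using (List; []; _∷_; [_]; map; _++_; length)
open import Data.List.Properties using (map-id-local; ++-assoc; ++-identityʳ)
open import Data.List.Relation.Binary.Permutation.Propositional using (_↭_; refl; prep; swap; trans; ↭-sym; ↭-trans; ↭-reflexive)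
import Data.List.Relation.Binary.Permutation.Propositional.Properties as ↭
open import Data.List.Relation.Binary.Pointwise as Pointwise using (Pointwise; []; _∷_)
open import Data.List.Relation.Unary.All as All using (All; []; _∷_)
open import Data.List.Relation.Unary.All.Properties using (map⁺; ++⁺; ++⁻ˡ; ++⁻ʳ)
open import Data.List.Relation.Unary.Any using (here; there)
open import Data.List.Membership.Propositional using (_∈_)
open import Data.List.Membership.Propositional.Properties using (∈-++⁺ʳ)
open import Data.Unit using (⊤; tt)
open import Data.Product using (Σ; _×_; _,_; ∃-syntax; proj₁; proj₂)
open import Relation.Binary.PropositionalEquality using (_≡_; refl; sym; cong; cong₂; subst; module ≡-Reasoning)
import Relation.Binary.PropositionalEquality as ≡

sumSize≡sum : ∀ Γ → sumSize Γ ≡ sum (map fsize Γ)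
sumSize≡sum []      = refl
sumSize≡sum (A ∷ Γ) = cong (fsize A +_) (sumSize≡sum Γ)

sumSize-↭ : ∀ {Γ Γ'} → Γ ↭ Γ' → sumSize Γ ≡ sumSize Γ'
sumSize-↭ {Γ} {Γ'} p = begin
  sumSize Γ          ≡⟨ sumSize≡sum Γ ⟩
  sum (map fsize Γ)  ≡⟨ sum-↭ (↭.map⁺ fsize p) ⟩
  sum (map fsize Γ') ≡⟨ sumSize≡sum Γ' ⟨
  sumSize Γ'         ∎
  where open ≡-Reasoning

ssize-≈S : ∀ {s s'} → s ≈S s' → ssize s ≡ ssize s'
ssize-≈S {_ , _} {_ , _} (p , q) = cong₂ _+_ (sumSize-↭ p) (sumSize-↭ q)

fsize≥1 : ∀ A → 1 ≤ fsize A
fsize≥1 (lit p)     = ≤-refl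
fsize≥1 (dec A p B) = ≤-trans (fsize≥1 A) (≤-trans (m≤m+n (fsize A) 1) (m≤m+n _ (fsize B)))
fsize≥1 (A ∨ B)     = ≤-trans (fsize≥1 A) (m≤m+n (fsize A) (fsize B))

length≤sumSize : ∀ Γ → length Γ ≤ sumSize Γ
length≤sumSize []      = z≤n
length≤sumSize (A ∷ Γ) = +-mono-≤ (fsize≥1 A) (length≤sumSize Γ)

≈S-refl : ∀ {s} → s ≈S s
≈S-refl {_ , _} = refl , refl

≈S-sym : ∀ {s s'} → s ≈S s' → s' ≈S s
≈S-sym {_ , _} {_ , _} (p , q) = ↭-sym p , ↭-sym q

≈S-trans : ∀ {s s' s''} → s ≈S s' → s' ≈S s'' → s ≈S s''
≈S-trans {_ , _} {_ , _} {_ , _} (p , q) (p' , q') = ↭-trans p p' , ↭-trans q q'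

SeqNF-resp-≈S : ∀ {s s'} → s ≈S s' → SeqNF s → SeqNF s'
SeqNF-resp-≈S {_ , _} {_ , _} (p , q) (nΓ , nΔ) = ↭.All-resp-↭ p nΓ , ↭.All-resp-↭ q nΔ

step : ∀ {ps s} → Inf ps s → Step ps s
step {ps} {s} i = ps , s , i , Pointwise.refl ≈S-refl , ≈S-refl

Step-resp-≈S : ∀ {ps s s'} → Step ps s → s ≈S s' → Step ps s'
Step-resp-≈S (ps' , s'' , i , pw , e) e' = ps' , s'' , i , pw , ≈S-trans (≈S-sym e') e

-- The translation into normal form

-- (a p p̄) and (p p b) are the decision-tree forms of ¬p ∧ a and p ∧ b.
negGuard : Lit → Fml → Fml
negGuard p a = dec a p (lit (p ᶜ))

posGuard : Lit → Fml → Fml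
posGuard p b = dec (lit p) p b

mapDisjuncts : (Fml → Fml) → Fml → Fml
mapDisjuncts f (A ∨ B)     = mapDisjuncts f A ∨ mapDisjuncts f B
mapDisjuncts f (lit q)     = f (lit q)
mapDisjuncts f (dec A q B) = f (dec A q B)

-- (⋁ Fᵢ) p (⋁ Gⱼ)  is equivalent to  ⋁ (¬p ∧ Fᵢ) ∨ ⋁ (p ∧ Gⱼ).
distribute : Fml → Lit → Fml → Fml
distribute F p G = mapDisjuncts (negGuard p) F ∨ mapDisjuncts (posGuard p) G

-- A decision node is distributed only when a branch is a genuine
-- disjunction, so that nf fixes every formula in normal form.
decNF : Fml → Lit → Fml → Fml
decNF (F₁ ∨ F₂)   p G             = distribute (F₁ ∨ F₂) p G
decNF (lit q)     p (G₁ ∨ G₂)     = distribute (lit q) p (G₁ ∨ G₂)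
decNF (dec A q B) p (G₁ ∨ G₂)     = distribute (dec A q B) p (G₁ ∨ G₂)
decNF (lit q)     p (lit r)       = dec (lit q) p (lit r)
decNF (lit q)     p (dec A r B)   = dec (lit q) p (dec A r B)
decNF (dec A q B) p (lit r)       = dec (dec A q B) p (lit r)
decNF (dec A q B) p (dec A' r B') = dec (dec A q B) p (dec A' r B')

nf : Fml → Fml
nf (lit p)     = lit p
nf (dec A p B) = decNF (nf A) p (nf B)
nf (A ∨ B)     = nf A ∨ nf B

nfSeq : Seq → Seq
nfSeq (Γ , Δ) = map nf Γ , map nf Δ

mapDisjuncts-NF : ∀ {f} → (∀ {a} → IsDT a → IsDT (f a)) → ∀ {F} → IsNF F → IsNF (mapDisjuncts f F)
mapDisjuncts-NF f-DT (dt (lit p))     = dt (f-DT (lit p))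
mapDisjuncts-NF f-DT (dt (dec p d e)) = dt (f-DT (dec p d e))
mapDisjuncts-NF f-DT (or nA nB)       = or (mapDisjuncts-NF f-DT nA) (mapDisjuncts-NF f-DT nB)

negGuard-DT : ∀ p {a} → IsDT a → IsDT (negGuard p a)
negGuard-DT p d = dec p d (lit (p ᶜ))

posGuard-DT : ∀ p {b} → IsDT b → IsDT (posGuard p b)
posGuard-DT p = dec p (lit p)

distribute-NF : ∀ {F G} p → IsNF F → IsNF G → IsNF (distribute F p G)
distribute-NF p nF nG = or (mapDisjuncts-NF (negGuard-DT p) nF) (mapDisjuncts-NF (posGuard-DT p) nG)

decNF-DT : ∀ {A B} p → IsDT A → IsDT B → decNF A p B ≡ dec A p B
decNF-DT p (lit q)     (lit r)     = refl
decNF-DT p (lit q)     (dec r _ _) = refl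
decNF-DT p (dec q _ _) (lit r)     = refl
decNF-DT p (dec q _ _) (dec r _ _) = refl

data DecNFView (F : Fml) (p : Lit) (G : Fml) : Set where
  kept        : IsDT F → IsDT G → decNF F p G ≡ dec F p G → DecNFView F p G
  distributed : decNF F p G ≡ distribute F p G → DecNFView F p G

decNF-view : ∀ {F G} p → IsNF F → IsNF G → DecNFView F p G
decNF-view p (or _ _)         _        = distributed refl
decNF-view p (dt (lit _))     (or _ _) = distributed refl
decNF-view p (dt (dec _ _ _)) (or _ _) = distributed refl
decNF-view p (dt d)           (dt e)   = kept d e (decNF-DT p d e)

decNF-NF : ∀ {F G} p → IsNF F → IsNF G → IsNF (decNF F p G)
decNF-NF p nF nG with decNF-view p nF nG
... | kept d e eq      = subst IsNF (sym eq) (dt (dec p d e))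
... | distributed eq   = subst IsNF (sym eq) (distribute-NF p nF nG)

nf-NF : ∀ A → IsNF (nf A)
nf-NF (lit p)     = dt (lit p)
nf-NF (dec A p B) = decNF-NF p (nf-NF A) (nf-NF B)
nf-NF (A ∨ B)     = or (nf-NF A) (nf-NF B)

nfSeq-NF : ∀ s → SeqNF (nfSeq s)
nfSeq-NF (Γ , Δ) = map⁺ (All.universal nf-NF Γ) , map⁺ (All.universal nf-NF Δ)

nf-DT : ∀ {A} → IsDT A → nf A ≡ A
nf-DT (lit p)     = refl
nf-DT (dec {A} {B} p d e) = begin
  decNF (nf A) p (nf B) ≡⟨ cong₂ (λ A' B' → decNF A' p B') (nf-DT d) (nf-DT e) ⟩
  decNF A p B           ≡⟨ decNF-DT p d e ⟩
  dec A p B             ∎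
  where open ≡-Reasoning

nf-NF-id : ∀ {A} → IsNF A → nf A ≡ A
nf-NF-id (dt d)     = nf-DT d
nf-NF-id (or nA nB) = cong₂ _∨_ (nf-NF-id nA) (nf-NF-id nB)

nfSeq-id : ∀ {s} → SeqNF s → nfSeq s ≡ s
nfSeq-id {_ , _} (nΓ , nΔ) = cong₂ _,_ (map-id-local (All.map nf-NF-id nΓ)) (map-id-local (All.map nf-NF-id nΔ))

nfSeq-≈S : ∀ {s s'} → s ≈S s' → nfSeq s ≈S nfSeq s'
nfSeq-≈S {_ , _} {_ , _} (p , q) = ↭.map⁺ nf p , ↭.map⁺ nf q

-- The quadratic size bound of the translation

#disjuncts : Fml → ℕ
#disjuncts (A ∨ B)     = #disjuncts A + #disjuncts B
#disjuncts (lit _)     = 1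
#disjuncts (dec _ _ _) = 1

#disjuncts≥1 : ∀ F → 1 ≤ #disjuncts F
#disjuncts≥1 (A ∨ B)     = ≤-trans (#disjuncts≥1 A) (m≤m+n _ _)
#disjuncts≥1 (lit _)     = ≤-refl
#disjuncts≥1 (dec _ _ _) = ≤-refl

module _ {f : Fml → Fml} (f-size : ∀ a → fsize (f a) ≡ 2 + fsize a) (f-single : ∀ a → #disjuncts (f a) ≡ 1) where

  fsize-mapDisjuncts : ∀ F → fsize (mapDisjuncts f F) ≡ fsize F + 2 * #disjuncts F
  fsize-mapDisjuncts (A ∨ B) =
    ≡.trans (cong₂ _+_ (fsize-mapDisjuncts A) (fsize-mapDisjuncts B)) (lemma (fsize A) (fsize B) (#disjuncts A) (#disjuncts B))
    where lemma : ∀ a b x y → a + 2 * x + (b + 2 * y) ≡ a + b + 2 * (x + y)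
          lemma = solve-∀
  fsize-mapDisjuncts (lit q)     = f-size (lit q)
  fsize-mapDisjuncts (dec A q B) = ≡.trans (f-size (dec A q B)) (+-comm 2 _)

  #disjuncts-mapDisjuncts : ∀ F → #disjuncts (mapDisjuncts f F) ≡ #disjuncts F
  #disjuncts-mapDisjuncts (A ∨ B)     = cong₂ _+_ (#disjuncts-mapDisjuncts A) (#disjuncts-mapDisjuncts B)
  #disjuncts-mapDisjuncts (lit q)     = f-single (lit q)
  #disjuncts-mapDisjuncts (dec A q B) = f-single (dec A q B)

negGuard-size : ∀ p a → fsize (negGuard p a) ≡ 2 + fsize a
negGuard-size p a = ≡.trans (+-comm (fsize a + 1) 1) (cong suc (+-comm (fsize a) 1))

fsize-mapNegGuard : ∀ p F → fsize (mapDisjuncts (negGuard p) F) ≡ fsize F + 2 * #disjuncts F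
fsize-mapNegGuard p = fsize-mapDisjuncts (negGuard-size p) (λ _ → refl)

fsize-mapPosGuard : ∀ p G → fsize (mapDisjuncts (posGuard p) G) ≡ fsize G + 2 * #disjuncts G
fsize-mapPosGuard p = fsize-mapDisjuncts (λ _ → refl) (λ _ → refl)

distribute-size : ∀ F p G → fsize (distribute F p G) ≡ fsize F + fsize G + 2 * (#disjuncts F + #disjuncts G)
distribute-size F p G =
  ≡.trans (cong₂ _+_ (fsize-mapNegGuard p F) (fsize-mapPosGuard p G)) (lemma (fsize F) (fsize G) (#disjuncts F) (#disjuncts G))
  where lemma : ∀ a b x y → a + 2 * x + (b + 2 * y) ≡ a + b + 2 * (x + y)
        lemma = solve-∀

distribute-#disjuncts : ∀ F p G → #disjuncts (distribute F p G) ≡ #disjuncts F + #disjuncts G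
distribute-#disjuncts F p G =
  cong₂ _+_ (#disjuncts-mapDisjuncts (negGuard-size p) (λ _ → refl) F) (#disjuncts-mapDisjuncts (λ _ → refl) (λ _ → refl) G)

decNF-size : ∀ {F G} p → IsNF F → IsNF G →
             fsize (decNF F p G) ≤ fsize F + fsize G + 2 * (#disjuncts F + #disjuncts G) + 1
decNF-size {F} {G} p nF nG with decNF-view p nF nG
... | kept _ _ eq    = subst (_≤ _) (sym (cong fsize eq))
  (≤-trans (≤-reflexive (lemma (fsize F) (fsize G))) (+-monoˡ-≤ 1 (m≤m+n (fsize F + fsize G) _)))
  where lemma : ∀ a b → a + 1 + b ≡ a + b + 1
        lemma = solve-∀
... | distributed eq = subst (_≤ _) (sym (cong fsize eq))
  (≤-trans (≤-reflexive (distribute-size F p G)) (m≤m+n _ 1))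

decNF-#disjuncts : ∀ {F G} p → IsNF F → IsNF G → #disjuncts (decNF F p G) ≤ #disjuncts F + #disjuncts G
decNF-#disjuncts {F} {G} p nF nG with decNF-view p nF nG
... | kept _ _ eq    = subst (_≤ _) (sym (cong #disjuncts eq)) (≤-trans (#disjuncts≥1 F) (m≤m+n _ _))
... | distributed eq = subst (_≤ _) (sym (cong #disjuncts eq)) (≤-reflexive (distribute-#disjuncts F p G))

nf-#disjuncts : ∀ A → #disjuncts (nf A) ≤ fsize A
nf-#disjuncts (lit p)     = ≤-refl
nf-#disjuncts (dec A p B) = ≤-trans (decNF-#disjuncts p (nf-NF A) (nf-NF B))
  (≤-trans (+-mono-≤ (nf-#disjuncts A) (nf-#disjuncts B)) (+-monoˡ-≤ (fsize B) (m≤m+n (fsize A) 1)))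
nf-#disjuncts (A ∨ B)     = +-mono-≤ (nf-#disjuncts A) (nf-#disjuncts B)

m²+n²≤[m+n]² : ∀ m n → m * m + n * n ≤ (m + n) * (m + n)
m²+n²≤[m+n]² m n = ≤-trans (m≤m+n _ (2 * m * n)) (≤-reflexive (lemma m n))
  where lemma : ∀ m n → m * m + n * n + 2 * m * n ≡ (m + n) * (m + n)
        lemma = solve-∀

-- Distributing a node adds two guard literals per disjunct, and nf A has at
-- most |A| disjuncts.
nf-size : ∀ A → fsize (nf A) ≤ fsize A * fsize A
nf-size (lit p)     = ≤-refl
nf-size (dec A p B) = begin
  fsize (decNF (nf A) p (nf B))
    ≤⟨ decNF-size p (nf-NF A) (nf-NF B) ⟩
  fsize (nf A) + fsize (nf B) + 2 * (#disjuncts (nf A) + #disjuncts (nf B)) + 1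
    ≤⟨ +-monoˡ-≤ 1 (+-mono-≤ (+-mono-≤ (nf-size A) (nf-size B))
                             (*-monoʳ-≤ 2 (+-mono-≤ (nf-#disjuncts A) (nf-#disjuncts B)))) ⟩
  a * a + b * b + 2 * (a + b) + 1
    ≤⟨ m≤m+n _ (2 * a * b) ⟩
  a * a + b * b + 2 * (a + b) + 1 + 2 * a * b
    ≡⟨ lemma a b ⟩
  (a + 1 + b) * (a + 1 + b) ∎
  where
  open ≤-Reasoning
  a b : ℕ
  a = fsize A
  b = fsize B
  lemma : ∀ a b → a * a + b * b + 2 * (a + b) + 1 + 2 * a * b ≡ (a + 1 + b) * (a + 1 + b)
  lemma = solve-∀
nf-size (A ∨ B)     = ≤-trans (+-mono-≤ (nf-size A) (nf-size B)) (m²+n²≤[m+n]² (fsize A) (fsize B))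

sumSize-map-nf : ∀ Γ → sumSize (map nf Γ) ≤ sumSize Γ * sumSize Γ
sumSize-map-nf []      = z≤n
sumSize-map-nf (A ∷ Γ) = ≤-trans (+-mono-≤ (nf-size A) (sumSize-map-nf Γ)) (m²+n²≤[m+n]² (fsize A) (sumSize Γ))

nfSeq-size : ∀ s → ssize (nfSeq s) ≤ ssize s * ssize s
nfSeq-size (Γ , Δ) = ≤-trans (+-mono-≤ (sumSize-map-nf Γ) (sumSize-map-nf Δ)) (m²+n²≤[m+n]² (sumSize Γ) (sumSize Δ))

-- Derivations from hypotheses

data Deriv : List Seq → Seq → Set where
  hyp   : ∀ {s s'} → s ≈S s' → SeqNF s' → Deriv [ s ] s'
  rule0 : ∀ {s} → Step [] s → SeqNF s → Deriv [] s
  rule1 : ∀ {hs s₁ s} → Step [ s₁ ] s → SeqNF s → Deriv hs s₁ → Deriv hs s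
  rule2 : ∀ {hs₁ hs₂ s₁ s₂ s} → Step (s₁ ∷ s₂ ∷ []) s → SeqNF s →
          Deriv hs₁ s₁ → Deriv hs₂ s₂ → Deriv (hs₁ ++ hs₂) s

-- Hypothesis leaves are free: their lines belong to the proofs plugged in for them.
dsize : ∀ {hs s} → Deriv hs s → ℕ
dsize (hyp _ _)               = 0
dsize (rule0 {s} _ _)         = ssize s
dsize (rule1 {s = s} _ _ d)   = ssize s + dsize d
dsize (rule2 {s = s} _ _ d e) = ssize s + (dsize d + dsize e)

data EndsInRule : ∀ {hs s} → Deriv hs s → Set where
  rule0 : ∀ {s} {st : Step [] s} {n} → EndsInRule (rule0 st n)
  rule1 : ∀ {hs s₁ s} {st : Step [ s₁ ] s} {n} {d : Deriv hs s₁} → EndsInRule (rule1 st n d)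
  rule2 : ∀ {hs₁ hs₂ s₁ s₂ s} {st : Step (s₁ ∷ s₂ ∷ []) s} {n} {d : Deriv hs₁ s₁} {e : Deriv hs₂ s₂} →
          EndsInRule (rule2 st n d e)

rootNF : ∀ {hs s} → Deriv hs s → SeqNF s
rootNF (hyp _ n)       = n
rootNF (rule0 _ n)     = n
rootNF (rule1 _ n _)   = n
rootNF (rule2 _ n _ _) = n

Deriv-resp-≈S : ∀ {hs s s'} → s ≈S s' → Deriv hs s → Deriv hs s'
Deriv-resp-≈S e (hyp e' n)       = hyp (≈S-trans e' e) (SeqNF-resp-≈S e n)
Deriv-resp-≈S e (rule0 st n)     = rule0 (Step-resp-≈S st e) (SeqNF-resp-≈S e n)
Deriv-resp-≈S e (rule1 st n d)   = rule1 (Step-resp-≈S st e) (SeqNF-resp-≈S e n) d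
Deriv-resp-≈S e (rule2 st n d d') = rule2 (Step-resp-≈S st e) (SeqNF-resp-≈S e n) d d'

dsize-resp-≈S : ∀ {hs s s'} (e : s ≈S s') (d : Deriv hs s) → dsize (Deriv-resp-≈S e d) ≡ dsize d
dsize-resp-≈S e (hyp _ _)        = refl
dsize-resp-≈S e (rule0 _ _)      = sym (ssize-≈S e)
dsize-resp-≈S e (rule1 _ _ d)    = cong (_+ dsize d) (sym (ssize-≈S e))
dsize-resp-≈S e (rule2 _ _ d d') = cong (_+ (dsize d + dsize d')) (sym (ssize-≈S e))

EndsInRule-resp-≈S : ∀ {hs s s'} (e : s ≈S s') {d : Deriv hs s} → EndsInRule d → EndsInRule (Deriv-resp-≈S e d)
EndsInRule-resp-≈S e rule0 = rule0
EndsInRule-resp-≈S e rule1 = rule1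
EndsInRule-resp-≈S e rule2 = rule2

NFTreeFor : Seq → Set
NFTreeFor h = Σ Seq λ s → s ≈S h × Σ (Tree s) TreeNF

treeSizes : ∀ {hs} → All NFTreeFor hs → ℕ
treeSizes []                    = 0
treeSizes ((_ , _ , t , _) ∷ a) = treeSize t + treeSizes a

treeSizes-++ : ∀ hs₁ {hs₂} (a : All NFTreeFor (hs₁ ++ hs₂)) →
               treeSizes (++⁻ˡ hs₁ a) + treeSizes (++⁻ʳ hs₁ a) ≡ treeSizes a
treeSizes-++ []        a                    = refl
treeSizes-++ (_ ∷ hs₁) ((_ , _ , t , _) ∷ a) =
  ≡.trans (+-assoc (treeSize t) _ _) (cong (treeSize t +_) (treeSizes-++ hs₁ a))

Tree-resp-≈S : ∀ {s s'} → s ≈S s' → Σ (Tree s) TreeNF → Σ (Tree s') TreeNF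
Tree-resp-≈S e (node st ts , n , nts) = node (Step-resp-≈S st e) ts , SeqNF-resp-≈S e n , nts

treeSize-resp-≈S : ∀ {s s'} (e : s ≈S s') (t : Σ (Tree s) TreeNF) →
                   treeSize (proj₁ (Tree-resp-≈S e t)) ≡ treeSize (proj₁ t)
treeSize-resp-≈S e (node st ts , _) = cong (_+ treesSize ts) (sym (ssize-≈S e))

graft : ∀ {hs s} (d : Deriv hs s) (a : All NFTreeFor hs) →
        Σ (Tree s) λ t → TreeNF t × treeSize t ≤ dsize d + treeSizes a
graft (hyp e n) ((_ , e₀ , t) ∷ []) =
  proj₁ t' , proj₂ t' ,
  ≤-reflexive (≡.trans (treeSize-resp-≈S (≈S-trans e₀ e) t) (sym (+-identityʳ _)))
  where t' : Σ (Tree _) TreeNF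
        t' = Tree-resp-≈S (≈S-trans e₀ e) t
graft (rule0 st n) [] = node st [] , (n , tt) , ≤-refl
graft (rule1 {s = s} st n d) a with graft d a
... | t , nt , le = node st (t ∷ []) , (n , nt , tt) ,
  ≤-trans (+-monoʳ-≤ (ssize s) (≤-trans (≤-reflexive (+-identityʳ _)) le)) (≤-reflexive (sym (+-assoc (ssize s) _ _)))
graft (rule2 {hs₁} {s = s} st n d e) a with graft d (++⁻ˡ hs₁ a) | graft e (++⁻ʳ hs₁ a)
... | t , nt , le | t' , nt' , le' = node st (t ∷ t' ∷ []) , (n , nt , nt' , tt) , (begin
  ssize s + (treeSize t + (treeSize t' + 0))
    ≡⟨ cong (λ z → ssize s + (treeSize t + z)) (+-identityʳ _) ⟩
  ssize s + (treeSize t + treeSize t')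
    ≤⟨ +-monoʳ-≤ (ssize s) (+-mono-≤ le le') ⟩
  ssize s + (dsize d + x + (dsize e + y))
    ≡⟨ lemma (ssize s) (dsize d) (dsize e) x y ⟩
  ssize s + (dsize d + dsize e) + (x + y)
    ≡⟨ cong (ssize s + (dsize d + dsize e) +_) (treeSizes-++ hs₁ a) ⟩
  ssize s + (dsize d + dsize e) + treeSizes a ∎)
  where
  open ≤-Reasoning
  x y : ℕ
  x = treeSizes (++⁻ˡ hs₁ a)
  y = treeSizes (++⁻ʳ hs₁ a)
  lemma : ∀ a b c x y → a + (b + x + (c + y)) ≡ a + (b + c) + (x + y)
  lemma = solve-∀

LineFor : List Seq → Seq → Set
LineFor ls h = Σ Seq λ s → s ∈ ls × s ≈S h

LineFor-++ : ∀ new {ls hs} → All (LineFor ls) hs → All (LineFor (new ++ ls)) hs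
LineFor-++ new = All.map λ (s , m , e) → s , ∈-++⁺ʳ new m , e

dagSize-++ : ∀ xs ys → dagSize (xs ++ ys) ≡ dagSize xs + dagSize ys
dagSize-++ []       ys = refl
dagSize-++ (x ∷ xs) ys = ≡.trans (cong (ssize x +_) (dagSize-++ xs ys)) (sym (+-assoc (ssize x) _ _))

-- Lines are stored last-first: the lines of d go in front of ls, and when d
-- ends in a rule its conclusion becomes the last line.
record Emitted {hs s} (d : Deriv hs s) (ls : List Seq) : Set where
  field
    new      : List Seq
    lines    : Lines (new ++ ls)
    new-NF   : All SeqNF new
    new-size : dagSize new ≤ dsize d
    root     : LineFor (new ++ ls) s
    last     : EndsInRule d → Σ (List Seq) λ rest → new ≡ s ∷ rest

emit : ∀ {hs s} (d : Deriv hs s) {ls} → Lines ls → All (LineFor ls) hs → Emitted d ls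
emit (hyp e n) L ((s₀ , m , e₀) ∷ []) = record
  { new = [] ; lines = L ; new-NF = [] ; new-size = z≤n ; root = s₀ , m , ≈S-trans e₀ e ; last = λ () }
emit (rule0 {s} st n) L [] = record
  { new = s ∷ [] ; lines = ([] , [] , st) ∷ L ; new-NF = n ∷ [] ; new-size = ≤-reflexive (+-identityʳ _)
  ; root = s , here refl , ≈S-refl ; last = λ _ → [] , refl }
emit (rule1 {s = s} (ps' , s' , i , (p ∷ []) , e) n d) L a with emit d L a
... | record { new = new ; lines = L' ; new-NF = nf' ; new-size = sz ; root = (s₀ , m , e₀) } = record
  { new      = s ∷ new
  ; lines    = ((s₀ ∷ []) , (m ∷ []) , (ps' , s' , i , (≈S-trans e₀ p ∷ []) , e)) ∷ L'
  ; new-NF   = n ∷ nf'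
  ; new-size = +-monoʳ-≤ (ssize s) sz
  ; root     = s , here refl , ≈S-refl
  ; last     = λ _ → new , refl }
emit (rule2 {hs₁} {s = s} (ps' , s' , i , (p ∷ q ∷ []) , e) n d₁ d₂) {ls} L a
  with emit d₁ L (++⁻ˡ hs₁ a)
... | record { new = new₁ ; lines = L₁ ; new-NF = nf₁ ; new-size = sz₁ ; root = (s₁ , m₁ , e₁) }
  with emit d₂ L₁ (LineFor-++ new₁ (++⁻ʳ hs₁ a))
... | record { new = new₂ ; lines = L₂ ; new-NF = nf₂ ; new-size = sz₂ ; root = (s₂ , m₂ , e₂) } = record
  { new      = s ∷ new₂ ++ new₁
  ; lines    = subst Lines (cong (s ∷_) (sym (++-assoc new₂ new₁ ls)))
      (((s₁ ∷ s₂ ∷ []) , (∈-++⁺ʳ new₂ m₁ ∷ m₂ ∷ []) , (ps' , s' , i , (≈S-trans e₁ p ∷ ≈S-trans e₂ q ∷ []) , e)) ∷ L₂)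
  ; new-NF   = n ∷ ++⁺ nf₂ nf₁
  ; new-size = +-monoʳ-≤ (ssize s) (≤-trans (≤-reflexive (≡.trans (dagSize-++ new₂ new₁) (+-comm (dagSize new₂) _)))
                                            (+-mono-≤ sz₁ sz₂))
  ; root     = s , here refl , ≈S-refl
  ; last     = λ _ → new₂ ++ new₁ , refl }

m+k≡n⇒m≤n : ∀ {m n} k → m + k ≡ n → m ≤ n
m+k≡n⇒m≤n {m} k refl = m≤m+n m k

record SizedDeriv (V N : ℕ) (hs : List Seq) (s : Seq) : Set where
  constructor sized
  field
    deriv : Deriv hs s
    bound : dsize deriv ≤ N * V
open SizedDeriv

sd-hyp : ∀ {V s} → SeqNF s → SizedDeriv V 0 [ s ] s
sd-hyp n = sized (hyp ≈S-refl n) z≤n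

sd-relax : ∀ {V V' N hs s} → V ≤ V' → SizedDeriv V N hs s → SizedDeriv V' N hs s
sd-relax {N = N} V≤V' (sized d h) = sized d (≤-trans h (*-monoʳ-≤ N V≤V'))

sd-perm : ∀ {V N hs s s'} → s ≈S s' → SizedDeriv V N hs s → SizedDeriv V N hs s'
sd-perm e (sized d h) = sized (Deriv-resp-≈S e d) (≤-trans (≤-reflexive (dsize-resp-≈S e d)) h)

sd-axiom : ∀ {V s} → Inf [] s → SeqNF s → ssize s ≤ V → SizedDeriv V 1 [] s
sd-axiom {V} i n le = sized (rule0 (step i) n) (≤-trans le (≤-reflexive (sym (*-identityˡ V))))

sd-rule1 : ∀ {V N hs s₁ s} → Inf [ s₁ ] s → SeqNF s → ssize s ≤ V →
           SizedDeriv V N hs s₁ → SizedDeriv V (suc N) hs s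
sd-rule1 i n le (sized d h) = sized (rule1 (step i) n d) (+-mono-≤ le h)

sd-rule2 : ∀ {V N₁ N₂ hs₁ hs₂ s₁ s₂ s} → Inf (s₁ ∷ s₂ ∷ []) s → SeqNF s → ssize s ≤ V →
           SizedDeriv V N₁ hs₁ s₁ → SizedDeriv V N₂ hs₂ s₂ → SizedDeriv V (suc (N₁ + N₂)) (hs₁ ++ hs₂) s
sd-rule2 {V} {N₁} {N₂} i n le (sized d h) (sized e k) =
  sized (rule2 (step i) n d e) (+-mono-≤ le (≤-trans (+-mono-≤ h k) (≤-reflexive (sym (*-distribʳ-+ V N₁ N₂)))))

module _ {V : ℕ} {Γ Δ : List Fml} where

  sd-weak-l : ∀ {N hs A} → IsNF A → ssize (A ∷ Γ , Δ) ≤ V →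
              SizedDeriv V N hs (Γ , Δ) → SizedDeriv V (suc N) hs (A ∷ Γ , Δ)
  sd-weak-l nA le D = sd-rule1 weak-l (nA ∷ proj₁ (rootNF (deriv D)) , proj₂ (rootNF (deriv D))) le D

  sd-weak-r : ∀ {N hs A} → IsNF A → ssize (Γ , A ∷ Δ) ≤ V →
              SizedDeriv V N hs (Γ , Δ) → SizedDeriv V (suc N) hs (Γ , A ∷ Δ)
  sd-weak-r nA le D = sd-rule1 weak-r (proj₁ (rootNF (deriv D)) , nA ∷ proj₂ (rootNF (deriv D))) le D

  sd-cut : ∀ {N₁ N₂ hs₁ hs₂ A} → ssize (Γ , Δ) ≤ V →
           SizedDeriv V N₁ hs₁ (Γ , A ∷ Δ) → SizedDeriv V N₂ hs₂ (A ∷ Γ , Δ) →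
           SizedDeriv V (suc (N₁ + N₂)) (hs₁ ++ hs₂) (Γ , Δ)
  sd-cut le D E = sd-rule2 cut (proj₁ (rootNF (deriv D)) , All.tail (proj₂ (rootNF (deriv D)))) le D E

  sd-dec-l : ∀ {N₁ N₂ hs₁ hs₂ A B p} → IsNF (dec A p B) → ssize (dec A p B ∷ Γ , Δ) ≤ V →
             SizedDeriv V N₁ hs₁ (A ∷ Γ , lit p ∷ Δ) → SizedDeriv V N₂ hs₂ (lit p ∷ B ∷ Γ , Δ) →
             SizedDeriv V (suc (N₁ + N₂)) (hs₁ ++ hs₂) (dec A p B ∷ Γ , Δ)
  sd-dec-l nD le D E = sd-rule2 dec-l (nD ∷ All.tail (proj₁ (rootNF (deriv D))) , proj₂ (rootNF (deriv E))) le D E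

  sd-dec-r : ∀ {N₁ N₂ hs₁ hs₂ A B p} → IsNF (dec A p B) → ssize (Γ , dec A p B ∷ Δ) ≤ V →
             SizedDeriv V N₁ hs₁ (Γ , A ∷ lit p ∷ Δ) → SizedDeriv V N₂ hs₂ (lit p ∷ Γ , B ∷ Δ) →
             SizedDeriv V (suc (N₁ + N₂)) (hs₁ ++ hs₂) (Γ , dec A p B ∷ Δ)
  sd-dec-r nD le D E = sd-rule2 dec-r (proj₁ (rootNF (deriv D)) , nD ∷ All.tail (All.tail (proj₂ (rootNF (deriv D))))) le D E

  sd-∨-l : ∀ {N₁ N₂ hs₁ hs₂ A B} → ssize (A ∨ B ∷ Γ , Δ) ≤ V →
           SizedDeriv V N₁ hs₁ (A ∷ Γ , Δ) → SizedDeriv V N₂ hs₂ (B ∷ Γ , Δ) →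
           SizedDeriv V (suc (N₁ + N₂)) (hs₁ ++ hs₂) (A ∨ B ∷ Γ , Δ)
  sd-∨-l {A = A} le D E =
    sd-rule2 ∨-l (or (All.head nAΓ) (All.head (proj₁ (rootNF (deriv E)))) ∷ All.tail nAΓ , proj₂ (rootNF (deriv D))) le D E
    where nAΓ : All IsNF (A ∷ Γ)
          nAΓ = proj₁ (rootNF (deriv D))

  sd-∨-r : ∀ {N hs A B} → ssize (Γ , A ∨ B ∷ Δ) ≤ V →
           SizedDeriv V N hs (Γ , A ∷ B ∷ Δ) → SizedDeriv V (suc N) hs (Γ , A ∨ B ∷ Δ)
  sd-∨-r {A = A} {B} le D =
    sd-rule1 ∨-r (proj₁ (rootNF (deriv D)) , or (All.head nABΔ) (All.head (All.tail nABΔ)) ∷ All.tail (All.tail nABΔ)) le D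
    where nABΔ : All IsNF (A ∷ B ∷ Δ)
          nABΔ = proj₂ (rootNF (deriv D))

Proof : ℕ → Seq → Set
Proof N s = SizedDeriv (ssize s) N [] s

pf-perm : ∀ {N s s'} → s ≈S s' → Proof N s → Proof N s'
pf-perm e P = sd-relax (≤-reflexive (ssize-≈S e)) (sd-perm e P)

pf-ax-id : ∀ p → Proof 1 (lit p ∷ [] , lit p ∷ [])
pf-ax-id p = sd-axiom (ax-id p) (dt (lit p) ∷ [] , dt (lit p) ∷ []) ≤-refl

pf-ax-l : ∀ p → Proof 1 (lit p ∷ lit (p ᶜ) ∷ [] , [])
pf-ax-l p = sd-axiom (ax-l p) (dt (lit p) ∷ dt (lit (p ᶜ)) ∷ [] , []) ≤-refl

module _ {Γ Δ : List Fml} where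
  private
    g d : ℕ
    g = sumSize Γ
    d = sumSize Δ

  pf-weak-l : ∀ {N A} → IsNF A → Proof N (Γ , Δ) → Proof (suc N) (A ∷ Γ , Δ)
  pf-weak-l {A = A} nA P = sd-weak-l nA ≤-refl (sd-relax (+-monoˡ-≤ d (m≤n+m g (fsize A))) P)

  pf-weak-r : ∀ {N A} → IsNF A → Proof N (Γ , Δ) → Proof (suc N) (Γ , A ∷ Δ)
  pf-weak-r {A = A} nA P = sd-weak-r nA ≤-refl (sd-relax (+-monoʳ-≤ g (m≤n+m d (fsize A))) P)

  pf-dec-l : ∀ {N₁ N₂ A B p} → IsNF (dec A p B) → Proof N₁ (A ∷ Γ , lit p ∷ Δ) → Proof N₂ (lit p ∷ B ∷ Γ , Δ) →
             Proof (suc (N₁ + N₂)) (dec A p B ∷ Γ , Δ)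
  pf-dec-l {A = A} {B} nD P Q = sd-dec-l nD ≤-refl
    (sd-relax (m+k≡n⇒m≤n (fsize B) (lemma₁ (fsize A) (fsize B) g d)) P)
    (sd-relax (m+k≡n⇒m≤n (fsize A) (lemma₂ (fsize A) (fsize B) g d)) Q)
    where lemma₁ : ∀ a b g d → a + g + (1 + d) + b ≡ a + 1 + b + g + d
          lemma₁ = solve-∀
          lemma₂ : ∀ a b g d → 1 + (b + g) + d + a ≡ a + 1 + b + g + d
          lemma₂ = solve-∀

  pf-dec-r : ∀ {N₁ N₂ A B p} → IsNF (dec A p B) → Proof N₁ (Γ , A ∷ lit p ∷ Δ) → Proof N₂ (lit p ∷ Γ , B ∷ Δ) →
             Proof (suc (N₁ + N₂)) (Γ , dec A p B ∷ Δ)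
  pf-dec-r {A = A} {B} nD P Q = sd-dec-r nD ≤-refl
    (sd-relax (m+k≡n⇒m≤n (fsize B) (lemma₁ (fsize A) (fsize B) g d)) P)
    (sd-relax (m+k≡n⇒m≤n (fsize A) (lemma₂ (fsize A) (fsize B) g d)) Q)
    where lemma₁ : ∀ a b g d → g + (a + (1 + d)) + b ≡ g + (a + 1 + b + d)
          lemma₁ = solve-∀
          lemma₂ : ∀ a b g d → 1 + g + (b + d) + a ≡ g + (a + 1 + b + d)
          lemma₂ = solve-∀

  pf-∨-l : ∀ {N₁ N₂ A B} → Proof N₁ (A ∷ Γ , Δ) → Proof N₂ (B ∷ Γ , Δ) → Proof (suc (N₁ + N₂)) (A ∨ B ∷ Γ , Δ)
  pf-∨-l {A = A} {B} P Q = sd-∨-l ≤-refl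
    (sd-relax (+-monoˡ-≤ d (+-monoˡ-≤ g (m≤m+n (fsize A) (fsize B)))) P)
    (sd-relax (+-monoˡ-≤ d (+-monoˡ-≤ g (m≤n+m (fsize B) (fsize A)))) Q)

  pf-∨-r : ∀ {N A B} → Proof N (Γ , A ∷ B ∷ Δ) → Proof (suc N) (Γ , A ∨ B ∷ Δ)
  pf-∨-r {A = A} {B} P = sd-∨-r ≤-refl (sd-relax (≤-reflexive (cong (g +_) (sym (+-assoc (fsize A) (fsize B) d)))) P)

pf-weaken-l : ∀ {N Γ₀ Δ₀} Γ → All IsNF Γ → Proof N (Γ₀ , Δ₀) → Proof (length Γ + N) (Γ₀ ++ Γ , Δ₀)
pf-weaken-l {Γ₀ = Γ₀} []      []        P = pf-perm (↭-reflexive (sym (++-identityʳ Γ₀)) , refl) P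
pf-weaken-l {Γ₀ = Γ₀} (A ∷ Γ) (nA ∷ nΓ) P = pf-perm (↭-sym (↭.shift A Γ₀ Γ) , refl) (pf-weak-l nA (pf-weaken-l Γ nΓ P))

pf-weaken-r : ∀ {N Γ₀ Δ₀} Δ → All IsNF Δ → Proof N (Γ₀ , Δ₀) → Proof (length Δ + N) (Γ₀ , Δ₀ ++ Δ)
pf-weaken-r {Δ₀ = Δ₀} []      []        P = pf-perm (refl , ↭-reflexive (sym (++-identityʳ Δ₀))) P
pf-weaken-r {Δ₀ = Δ₀} (A ∷ Δ) (nA ∷ nΔ) P = pf-perm (refl , ↭-sym (↭.shift A Δ₀ Δ)) (pf-weak-r nA (pf-weaken-r Δ nΔ P))

pf-weaken : ∀ {N Γ₀ Δ₀} Γ Δ → All IsNF Γ → All IsNF Δ → Proof N (Γ₀ , Δ₀) →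
            Proof (length Δ + (length Γ + N)) (Γ₀ ++ Γ , Δ₀ ++ Δ)
pf-weaken Γ Δ nΓ nΔ P = pf-weaken-r Δ nΔ (pf-weaken-l Γ nΓ P)

-- Proofs with linearly many inferences

-- The slack 5 pays for the rules that join the proofs of two disjuncts.
record LinProof (F : Fml) (s : Seq) : Set where
  constructor linProof
  field
    nodes       : ℕ
    proof       : Proof nodes s
    nodes-bound : nodes + 5 ≤ 30 * fsize F

pf-weak-r-twice : ∀ {N Γ A B} → IsNF A → Proof N (Γ , B ∷ []) → Proof (2 + N) (Γ , B ∷ A ∷ A ∷ [])
pf-weak-r-twice {A = A} {B} nA P = pf-perm (refl , trans (prep A (swap A B refl)) (swap A B refl)) (pf-weak-r nA (pf-weak-r nA P))

pf-ax-id-weak : ∀ q {A B} → IsNF A → IsNF B → Proof 3 (lit q ∷ A ∷ [] , B ∷ lit q ∷ [])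
pf-ax-id-weak q {A} nA nB = pf-perm (swap A (lit q) refl , refl) (pf-weak-r nB (pf-weak-l nA (pf-ax-id q)))

identity : ∀ {a} → IsDT a → LinProof a (a ∷ [] , a ∷ [])
identity (lit p) = linProof 1 (pf-ax-id p) (m≤m+n 6 24)
identity (dec {A} {B} q d e) with identity d | identity e
... | linProof Na PA bA | linProof Nb PB bB = linProof _ (pf-dec-l nD left right) (begin
  suc (suc (2 + Na + 3) + suc (3 + (2 + Nb))) + 5 ≡⟨ lemma₁ Na Nb ⟩
  (Na + 5) + (Nb + 5) + 8                         ≤⟨ +-mono-≤ (+-mono-≤ bA bB) (m≤m+n 8 22) ⟩
  30 * fsize A + 30 * fsize B + 30                ≡⟨ lemma₂ (fsize A) (fsize B) ⟩
  30 * (fsize A + 1 + fsize B)                    ∎)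
  where
  open ≤-Reasoning
  nD : IsNF (dec A q B)
  nD = dt (dec q d e)
  left : Proof (suc (2 + Na + 3)) (A ∷ [] , lit q ∷ dec A q B ∷ [])
  left = pf-perm (refl , swap _ _ refl) (pf-dec-r nD (pf-weak-r-twice (dt (lit q)) PA) (pf-ax-id-weak q (dt d) (dt e)))
  right : Proof (suc (3 + (2 + Nb))) (lit q ∷ B ∷ [] , dec A q B ∷ [])
  right = pf-dec-r nD (pf-ax-id-weak q (dt e) (dt d)) (pf-weak-l (dt (lit q)) (pf-weak-l (dt (lit q)) PB))
  lemma₁ : ∀ a b → suc (suc (2 + a + 3) + suc (3 + (2 + b))) + 5 ≡ (a + 5) + (b + 5) + 8
  lemma₁ = solve-∀
  lemma₂ : ∀ a b → 30 * a + 30 * b + 30 ≡ 30 * (a + 1 + b)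
  lemma₂ = solve-∀

guard-bound : ∀ {N M b} a k → N ≡ M + k → k ≤ 60 → M ≤ 30 * a → b ≡ 2 + a → N ≤ 30 * b
guard-bound {M = M} a k refl k≤60 M≤ refl =
  ≤-trans (+-mono-≤ M≤ k≤60) (≤-reflexive (≡.trans (+-comm (30 * a) 60) (sym (*-distribˡ-+ 30 2 a))))

module _ (p : Lit) where

  negGuard-intro : ∀ {a} → IsDT a → LinProof (negGuard p a) (a ∷ [] , negGuard p a ∷ lit p ∷ [])
  negGuard-intro {a} d with identity d
  ... | linProof Na Pa ba = linProof _
    (pf-dec-r (dt (negGuard-DT p d)) (pf-weak-r-twice (dt (lit p)) Pa) (pf-ax-id-weak p (dt d) (dt (lit (p ᶜ)))))
    (guard-bound (fsize a) 6 (lemma Na) (m≤m+n 6 54) ba (negGuard-size p a))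
    where lemma : ∀ n → suc (2 + n + 3) + 5 ≡ n + 5 + 6
          lemma = solve-∀

  posGuard-intro : ∀ {b} → IsDT b → LinProof (posGuard p b) (b ∷ lit p ∷ [] , posGuard p b ∷ [])
  posGuard-intro {b} d with identity d
  ... | linProof Nb Pb bb = linProof _
    (pf-dec-r (dt (posGuard-DT p d))
      (pf-weak-r (dt (lit p)) (pf-weak-l (dt d) (pf-ax-id p)))
      (pf-perm (prep (lit p) (swap (lit p) b refl) , refl) (pf-weak-l (dt (lit p)) (pf-weak-l (dt (lit p)) Pb))))
    (guard-bound (fsize b) 6 (lemma Nb) (m≤m+n 6 54) bb refl)
    where lemma : ∀ n → suc (3 + (2 + n)) + 5 ≡ n + 5 + 6
          lemma = solve-∀

  negGuard-elim : ∀ {a} → IsDT a → LinProof (negGuard p a) (negGuard p a ∷ [] , a ∷ [])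
  negGuard-elim {a} d with identity d
  ... | linProof Na Pa ba = linProof _
    (pf-dec-l (dt (negGuard-DT p d)) (pf-weak-r (dt (lit p)) Pa) (pf-weak-r (dt d) (pf-ax-l p)))
    (guard-bound (fsize a) 4 (lemma Na) (m≤m+n 4 56) ba (negGuard-size p a))
    where lemma : ∀ n → suc (1 + n + 2) + 5 ≡ n + 5 + 4
          lemma = solve-∀

  negGuard-absurd : ∀ {a} → IsDT a → LinProof (negGuard p a) (negGuard p a ∷ lit p ∷ [] , [])
  negGuard-absurd {a} d = linProof _
    (pf-dec-l (dt (negGuard-DT p d)) (pf-weak-l (dt d) (pf-ax-id p))
      (pf-perm (prep (lit p) (swap (lit p) (lit (p ᶜ)) refl) , refl) (pf-weak-l (dt (lit p)) (pf-ax-l p))))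
    (guard-bound (fsize a) 10 refl (m≤m+n 10 50) z≤n (negGuard-size p a))

  posGuard-elim : ∀ {b} → IsDT b → LinProof (posGuard p b) (posGuard p b ∷ [] , b ∷ [])
  posGuard-elim {b} d with identity d
  ... | linProof Nb Pb bb = linProof _
    (pf-dec-l (dt (posGuard-DT p d))
      (pf-perm (refl , swap b (lit p) refl) (pf-weak-r (dt d) (pf-ax-id p)))
      (pf-weak-l (dt (lit p)) Pb))
    (guard-bound (fsize b) 4 (lemma Nb) (m≤m+n 4 56) bb refl)
    where lemma : ∀ n → suc (2 + (1 + n)) + 5 ≡ n + 5 + 4
          lemma = solve-∀

  posGuard-guard : ∀ {b} → IsDT b → LinProof (posGuard p b) (posGuard p b ∷ [] , lit p ∷ [])
  posGuard-guard {b} d = linProof _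
    (pf-dec-l (dt (posGuard-DT p d)) (pf-weak-r (dt (lit p)) (pf-ax-id p))
      (pf-perm (swap b (lit p) refl , refl) (pf-weak-l (dt d) (pf-ax-id p))))
    (guard-bound (fsize b) 10 refl (m≤m+n 10 50) z≤n refl)

pf-∨-r-inj₁ : ∀ {N Γ Δ A B} → IsNF B → Proof N (Γ , A ∷ Δ) → Proof (2 + N) (Γ , A ∨ B ∷ Δ)
pf-∨-r-inj₁ {A = A} {B} nB P = pf-∨-r (pf-perm (refl , swap B A refl) (pf-weak-r nB P))

pf-∨-r-inj₂ : ∀ {N Γ Δ A B} → IsNF A → Proof N (Γ , B ∷ Δ) → Proof (2 + N) (Γ , A ∨ B ∷ Δ)
pf-∨-r-inj₂ nA P = pf-∨-r (pf-weak-r nA P)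

∨-bound : ∀ {N₁ N₂} x y → N₁ + 5 ≤ 30 * x → N₂ + 5 ≤ 30 * y → suc (2 + N₁ + (2 + N₂)) + 5 ≤ 30 * (x + y)
∨-bound {N₁} {N₂} x y h k =
  ≤-trans (≤-reflexive (lemma N₁ N₂)) (≤-trans (+-mono-≤ h k) (≤-reflexive (sym (*-distribˡ-+ 30 x y))))
  where lemma : ∀ a b → suc (2 + a + (2 + b)) + 5 ≡ (a + 5) + (b + 5)
        lemma = solve-∀

module _ {f : Fml → Fml} (f-DT : ∀ {a} → IsDT a → IsDT (f a)) {Γ Δ : List Fml} where

  mapDisjuncts-elim : (∀ {a} → IsDT a → LinProof (f a) (f a ∷ Γ , Δ)) →
                      ∀ {F} → IsNF F → LinProof (mapDisjuncts f F) (mapDisjuncts f F ∷ Γ , Δ)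
  mapDisjuncts-elim leaf (dt (lit q))     = leaf (lit q)
  mapDisjuncts-elim leaf (dt (dec q d e)) = leaf (dec q d e)
  mapDisjuncts-elim leaf (or {F₁} {F₂} n₁ n₂) with mapDisjuncts-elim leaf n₁ | mapDisjuncts-elim leaf n₂
  ... | linProof N₁ P₁ b₁ | linProof N₂ P₂ b₂ = linProof _ (pf-∨-l P₁ P₂)
    (≤-trans (+-monoˡ-≤ 5 (s≤s (+-mono-≤ (m≤n+m N₁ 2) (m≤n+m N₂ 2)))) (∨-bound (fsize (mapDisjuncts f F₁)) (fsize (mapDisjuncts f F₂)) b₁ b₂))

  mapDisjuncts-mono : (∀ {a} → IsDT a → LinProof (f a) (a ∷ Γ , f a ∷ Δ)) →
                      ∀ {F} → IsNF F → LinProof (mapDisjuncts f F) (F ∷ Γ , mapDisjuncts f F ∷ Δ)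
  mapDisjuncts-mono leaf (dt (lit q))     = leaf (lit q)
  mapDisjuncts-mono leaf (dt (dec q d e)) = leaf (dec q d e)
  mapDisjuncts-mono leaf (or {F₁} {F₂} n₁ n₂) with mapDisjuncts-mono leaf n₁ | mapDisjuncts-mono leaf n₂
  ... | linProof N₁ P₁ b₁ | linProof N₂ P₂ b₂ = linProof _
    (pf-∨-l (pf-∨-r-inj₁ (mapDisjuncts-NF f-DT n₂) P₁) (pf-∨-r-inj₂ (mapDisjuncts-NF f-DT n₁) P₂)) (∨-bound (fsize (mapDisjuncts f F₁)) (fsize (mapDisjuncts f F₂)) b₁ b₂)

  mapDisjuncts-mono⁻ : (∀ {a} → IsDT a → LinProof (f a) (f a ∷ Γ , a ∷ Δ)) →
                       ∀ {F} → IsNF F → LinProof (mapDisjuncts f F) (mapDisjuncts f F ∷ Γ , F ∷ Δ)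
  mapDisjuncts-mono⁻ leaf (dt (lit q))     = leaf (lit q)
  mapDisjuncts-mono⁻ leaf (dt (dec q d e)) = leaf (dec q d e)
  mapDisjuncts-mono⁻ leaf (or {F₁} {F₂} n₁ n₂) with mapDisjuncts-mono⁻ leaf n₁ | mapDisjuncts-mono⁻ leaf n₂
  ... | linProof N₁ P₁ b₁ | linProof N₂ P₂ b₂ = linProof _
    (pf-∨-l (pf-∨-r-inj₁ n₂ P₁) (pf-∨-r-inj₂ n₁ P₂)) (∨-bound (fsize (mapDisjuncts f F₁)) (fsize (mapDisjuncts f F₂)) b₁ b₂)

-- Distributing a decision rule

-- Opaque, so that products with K are never unfolded into unary sums.
opaque
  K : ℕ
  K = 240

  240≤K : 240 ≤ K
  240≤K = ≤-refl

  K-nonZero : NonZero K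
  K-nonZero = _

RuleDeriv : List Seq → Seq → Set
RuleDeriv hs s = Σ (Deriv hs s) λ d → EndsInRule d × dsize d ≤ K * (ssize s * ssize s)

quadratic-bound : ∀ {N V w} → N ≤ 60 * w → V ≤ 4 * w → N * V ≤ K * (w * w)
quadratic-bound {N} {V} {w} N≤ V≤ =
  ≤-trans (*-mono-≤ N≤ V≤) (≤-trans (≤-reflexive (lemma w)) (*-monoˡ-≤ (w * w) 240≤K))
  where lemma : ∀ w → 60 * w * (4 * w) ≡ 240 * (w * w)
        lemma = solve-∀

rot3 : ∀ (a b c : Fml) {r} → a ∷ b ∷ c ∷ r ↭ c ∷ a ∷ b ∷ r
rot3 a b c = trans (prep a (swap b c refl)) (swap a c refl)

module Distribution {Γ Δ : List Fml} {F G : Fml} (p : Lit)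
                    (nΓ : All IsNF Γ) (nΔ : All IsNF Δ) (nF : IsNF F) (nG : IsNF G) where
  private
    X Y : Fml
    X = mapDisjuncts (negGuard p) F
    Y = mapDisjuncts (posGuard p) G

    nX : IsNF X
    nX = mapDisjuncts-NF (negGuard-DT p) nF
    nY : IsNF Y
    nY = mapDisjuncts-NF (posGuard-DT p) nG
    np : IsNF (lit p)
    np = dt (lit p)

    sG sD x y f g w V : ℕ
    sG = sumSize Γ
    sD = sumSize Δ
    x = fsize X
    y = fsize Y
    f = fsize F
    g = fsize G
    w = x + y + sG + sD
    V = w + f + g + 1

    V≤4w : V ≤ 4 * w
    V≤4w = ≤-trans (+-mono-≤ (+-mono-≤ (+-monoʳ-≤ w (≤-trans f≤x x≤w)) (≤-trans g≤y y≤w)) (≤-trans (fsize≥1 X) x≤w))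
                   (≤-reflexive (lemma w))
      where
      f≤x : f ≤ x
      f≤x = m+k≡n⇒m≤n _ (sym (fsize-mapNegGuard p F))
      g≤y : g ≤ y
      g≤y = m+k≡n⇒m≤n _ (sym (fsize-mapPosGuard p G))
      x+y≤w : x + y ≤ w
      x+y≤w = ≤-trans (m≤m+n (x + y) sG) (m≤m+n (x + y + sG) sD)
      x≤w : x ≤ w
      x≤w = ≤-trans (m≤m+n x y) x+y≤w
      y≤w : y ≤ w
      y≤w = ≤-trans (m≤n+m y x) x+y≤w
      lemma : ∀ w → w + w + w + w ≡ 4 * w
      lemma = solve-∀

    length≤ : length Γ ≤ sG × length Δ ≤ sD
    length≤ = length≤sumSize Γ , length≤sumSize Δ

    ctx+ : ℕ → ℕ
    ctx+ N = length Δ + (length Γ + N)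

    -- Each sequent below consists of distinct formulas among Γ, Δ, F, G, X, Y
    -- and p, so its size is at most V.
    X,Γ⊢F,p,Δ≤V : ssize (X ∷ Γ , F ∷ lit p ∷ Δ) ≤ V
    X,Γ⊢F,p,Δ≤V = m+k≡n⇒m≤n (y + g) (lemma x y sG sD f g)
      where lemma : ∀ x y sG sD f g → x + sG + (f + (1 + sD)) + (y + g) ≡ x + y + sG + sD + f + g + 1
            lemma = solve-∀
    X,F,Γ⊢p,Δ≤V : ssize (X ∷ F ∷ Γ , lit p ∷ Δ) ≤ V
    X,F,Γ⊢p,Δ≤V = m+k≡n⇒m≤n (y + g) (lemma x y sG sD f g)
      where lemma : ∀ x y sG sD f g → x + (f + sG) + (1 + sD) + (y + g) ≡ x + y + sG + sD + f + g + 1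
            lemma = solve-∀
    X,Γ⊢p,Δ≤V : ssize (X ∷ Γ , lit p ∷ Δ) ≤ V
    X,Γ⊢p,Δ≤V = m+k≡n⇒m≤n (y + f + g) (lemma x y sG sD f g)
      where lemma : ∀ x y sG sD f g → x + sG + (1 + sD) + (y + f + g) ≡ x + y + sG + sD + f + g + 1
            lemma = solve-∀
    p,X,Γ⊢Δ≤V : ssize (lit p ∷ X ∷ Γ , Δ) ≤ V
    p,X,Γ⊢Δ≤V = m+k≡n⇒m≤n (y + f + g) (lemma x y sG sD f g)
      where lemma : ∀ x y sG sD f g → 1 + (x + sG) + sD + (y + f + g) ≡ x + y + sG + sD + f + g + 1
            lemma = solve-∀
    X,Γ⊢Δ≤V : ssize (X ∷ Γ , Δ) ≤ V
    X,Γ⊢Δ≤V = m+k≡n⇒m≤n (y + f + g + 1) (lemma x y sG sD f g)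
      where lemma : ∀ x y sG sD f g → x + sG + sD + (y + f + g + 1) ≡ x + y + sG + sD + f + g + 1
            lemma = solve-∀
    Y,p,Γ⊢G,Δ≤V : ssize (Y ∷ lit p ∷ Γ , G ∷ Δ) ≤ V
    Y,p,Γ⊢G,Δ≤V = m+k≡n⇒m≤n (x + f) (lemma x y sG sD f g)
      where lemma : ∀ x y sG sD f g → y + (1 + sG) + (g + sD) + (x + f) ≡ x + y + sG + sD + f + g + 1
            lemma = solve-∀
    Y,p,G,Γ⊢Δ≤V : ssize (Y ∷ lit p ∷ G ∷ Γ , Δ) ≤ V
    Y,p,G,Γ⊢Δ≤V = m+k≡n⇒m≤n (x + f) (lemma x y sG sD f g)
      where lemma : ∀ x y sG sD f g → y + (1 + (g + sG)) + sD + (x + f) ≡ x + y + sG + sD + f + g + 1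
            lemma = solve-∀
    Y,p,Γ⊢Δ≤V : ssize (Y ∷ lit p ∷ Γ , Δ) ≤ V
    Y,p,Γ⊢Δ≤V = m+k≡n⇒m≤n (x + f + g) (lemma x y sG sD f g)
      where lemma : ∀ x y sG sD f g → y + (1 + sG) + sD + (x + f + g) ≡ x + y + sG + sD + f + g + 1
            lemma = solve-∀
    Y,Γ⊢p,Δ≤V : ssize (Y ∷ Γ , lit p ∷ Δ) ≤ V
    Y,Γ⊢p,Δ≤V = m+k≡n⇒m≤n (x + f + g) (lemma x y sG sD f g)
      where lemma : ∀ x y sG sD f g → y + sG + (1 + sD) + (x + f + g) ≡ x + y + sG + sD + f + g + 1
            lemma = solve-∀
    Y,Γ⊢Δ≤V : ssize (Y ∷ Γ , Δ) ≤ V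
    Y,Γ⊢Δ≤V = m+k≡n⇒m≤n (x + f + g + 1) (lemma x y sG sD f g)
      where lemma : ∀ x y sG sD f g → y + sG + sD + (x + f + g + 1) ≡ x + y + sG + sD + f + g + 1
            lemma = solve-∀
    X∨Y,Γ⊢Δ≤V : ssize (X ∨ Y ∷ Γ , Δ) ≤ V
    X∨Y,Γ⊢Δ≤V = m+k≡n⇒m≤n (f + g + 1) (lemma x y sG sD f g)
      where lemma : ∀ x y sG sD f g → x + y + sG + sD + (f + g + 1) ≡ x + y + sG + sD + f + g + 1
            lemma = solve-∀

    Γ⊢Y,F,p,Δ≤V : ssize (Γ , Y ∷ F ∷ lit p ∷ Δ) ≤ V
    Γ⊢Y,F,p,Δ≤V = m+k≡n⇒m≤n (x + g) (lemma x y sG sD f g)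
      where lemma : ∀ x y sG sD f g → sG + (y + (f + (1 + sD))) + (x + g) ≡ x + y + sG + sD + f + g + 1
            lemma = solve-∀
    Γ⊢X,Y,F,p,Δ≤V : ssize (Γ , X ∷ Y ∷ F ∷ lit p ∷ Δ) ≤ V
    Γ⊢X,Y,F,p,Δ≤V = m+k≡n⇒m≤n g (lemma x y sG sD f g)
      where lemma : ∀ x y sG sD f g → sG + (x + (y + (f + (1 + sD)))) + g ≡ x + y + sG + sD + f + g + 1
            lemma = solve-∀
    F,Γ⊢X,Y,p,Δ≤V : ssize (F ∷ Γ , X ∷ Y ∷ lit p ∷ Δ) ≤ V
    F,Γ⊢X,Y,p,Δ≤V = m+k≡n⇒m≤n g (lemma x y sG sD f g)
      where lemma : ∀ x y sG sD f g → f + sG + (x + (y + (1 + sD))) + g ≡ x + y + sG + sD + f + g + 1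
            lemma = solve-∀
    Γ⊢X,Y,p,Δ≤V : ssize (Γ , X ∷ Y ∷ lit p ∷ Δ) ≤ V
    Γ⊢X,Y,p,Δ≤V = m+k≡n⇒m≤n (f + g) (lemma x y sG sD f g)
      where lemma : ∀ x y sG sD f g → sG + (x + (y + (1 + sD))) + (f + g) ≡ x + y + sG + sD + f + g + 1
            lemma = solve-∀
    p,Γ⊢Y,G,Δ≤V : ssize (lit p ∷ Γ , Y ∷ G ∷ Δ) ≤ V
    p,Γ⊢Y,G,Δ≤V = m+k≡n⇒m≤n (x + f) (lemma x y sG sD f g)
      where lemma : ∀ x y sG sD f g → 1 + sG + (y + (g + sD)) + (x + f) ≡ x + y + sG + sD + f + g + 1
            lemma = solve-∀
    p,Γ⊢X,Y,G,Δ≤V : ssize (lit p ∷ Γ , X ∷ Y ∷ G ∷ Δ) ≤ V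
    p,Γ⊢X,Y,G,Δ≤V = m+k≡n⇒m≤n f (lemma x y sG sD f g)
      where lemma : ∀ x y sG sD f g → 1 + sG + (x + (y + (g + sD))) + f ≡ x + y + sG + sD + f + g + 1
            lemma = solve-∀
    G,p,Γ⊢X,Y,Δ≤V : ssize (G ∷ lit p ∷ Γ , X ∷ Y ∷ Δ) ≤ V
    G,p,Γ⊢X,Y,Δ≤V = m+k≡n⇒m≤n f (lemma x y sG sD f g)
      where lemma : ∀ x y sG sD f g → g + (1 + sG) + (x + (y + sD)) + f ≡ x + y + sG + sD + f + g + 1
            lemma = solve-∀
    p,Γ⊢X,Y,Δ≤V : ssize (lit p ∷ Γ , X ∷ Y ∷ Δ) ≤ V
    p,Γ⊢X,Y,Δ≤V = m+k≡n⇒m≤n (f + g) (lemma x y sG sD f g)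
      where lemma : ∀ x y sG sD f g → 1 + sG + (x + (y + sD)) + (f + g) ≡ x + y + sG + sD + f + g + 1
            lemma = solve-∀
    Γ⊢X,Y,Δ≤V : ssize (Γ , X ∷ Y ∷ Δ) ≤ V
    Γ⊢X,Y,Δ≤V = m+k≡n⇒m≤n (f + g + 1) (lemma x y sG sD f g)
      where lemma : ∀ x y sG sD f g → sG + (x + (y + sD)) + (f + g + 1) ≡ x + y + sG + sD + f + g + 1
            lemma = solve-∀
    Γ⊢X∨Y,Δ≤V : ssize (Γ , X ∨ Y ∷ Δ) ≤ V
    Γ⊢X∨Y,Δ≤V = m+k≡n⇒m≤n (f + g + 1) (lemma x y sG sD f g)
      where lemma : ∀ x y sG sD f g → sG + (x + y + sD) + (f + g + 1) ≡ x + y + sG + sD + f + g + 1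
            lemma = solve-∀

    open LinProof

    X⊢F : LinProof X (X ∷ [] , F ∷ [])
    X⊢F = mapDisjuncts-mono⁻ (negGuard-DT p) (negGuard-elim p) nF
    X,p⊢ : LinProof X (X ∷ lit p ∷ [] , [])
    X,p⊢ = mapDisjuncts-elim (negGuard-DT p) (negGuard-absurd p) nF
    Y⊢G : LinProof Y (Y ∷ [] , G ∷ [])
    Y⊢G = mapDisjuncts-mono⁻ (posGuard-DT p) (posGuard-elim p) nG
    Y⊢p : LinProof Y (Y ∷ [] , lit p ∷ [])
    Y⊢p = mapDisjuncts-elim (posGuard-DT p) (posGuard-guard p) nG
    F⊢X,p : LinProof X (F ∷ [] , X ∷ lit p ∷ [])
    F⊢X,p = mapDisjuncts-mono (negGuard-DT p) (negGuard-intro p) nF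
    G,p⊢Y : LinProof Y (G ∷ lit p ∷ [] , Y ∷ [])
    G,p⊢Y = mapDisjuncts-mono (posGuard-DT p) (posGuard-intro p) nG

    X,Γ⊢Δ : SizedDeriv V (suc (suc (ctx+ (suc (nodes X⊢F)) + 1) + ctx+ (nodes X,p⊢))) [ (F ∷ Γ , lit p ∷ Δ) ] (X ∷ Γ , Δ)
    X,Γ⊢Δ = sd-cut X,Γ⊢Δ≤V
      (sd-cut X,Γ⊢p,Δ≤V
        (sd-relax X,Γ⊢F,p,Δ≤V (pf-weaken Γ Δ nΓ nΔ (pf-perm (refl , swap (lit p) F refl) (pf-weak-r np (proof X⊢F)))))
        (sd-perm (swap X F refl , refl) (sd-weak-l nX X,F,Γ⊢p,Δ≤V (sd-hyp (nF ∷ nΓ , np ∷ nΔ)))))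
      (sd-relax p,X,Γ⊢Δ≤V (pf-perm (swap X (lit p) refl , refl) (pf-weaken Γ Δ nΓ nΔ (proof X,p⊢))))

    Y,Γ⊢Δ : SizedDeriv V (suc (ctx+ (nodes Y⊢p) + suc (ctx+ (suc (nodes Y⊢G)) + 1))) [ (lit p ∷ G ∷ Γ , Δ) ] (Y ∷ Γ , Δ)
    Y,Γ⊢Δ = sd-cut Y,Γ⊢Δ≤V
      (sd-relax Y,Γ⊢p,Δ≤V (pf-weaken Γ Δ nΓ nΔ (proof Y⊢p)))
      (sd-perm (swap Y (lit p) refl , refl) (sd-cut Y,p,Γ⊢Δ≤V
        (sd-relax Y,p,Γ⊢G,Δ≤V (pf-weaken Γ Δ nΓ nΔ (pf-perm (swap (lit p) Y refl , refl) (pf-weak-l np (proof Y⊢G)))))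
        (sd-perm (rot3 Y (lit p) G , refl) (sd-weak-l nY Y,p,G,Γ⊢Δ≤V (sd-hyp (np ∷ nG ∷ nΓ , nΔ))))))

    Γ⊢X,Y,p,Δ : SizedDeriv V (suc (2 + ctx+ (suc (nodes F⊢X,p)))) [ (Γ , F ∷ lit p ∷ Δ) ] (Γ , X ∷ Y ∷ lit p ∷ Δ)
    Γ⊢X,Y,p,Δ = sd-cut Γ⊢X,Y,p,Δ≤V
      (sd-perm (refl , rot3 X Y F) (sd-weak-r nX Γ⊢X,Y,F,p,Δ≤V (sd-weak-r nY Γ⊢Y,F,p,Δ≤V (sd-hyp (nΓ , nF ∷ np ∷ nΔ)))))
      (sd-relax F,Γ⊢X,Y,p,Δ≤V (pf-weaken Γ Δ nΓ nΔ (pf-perm (refl , swap Y X refl) (pf-weak-r nY (proof F⊢X,p)))))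

    p,Γ⊢X,Y,Δ : SizedDeriv V (suc (2 + ctx+ (suc (nodes G,p⊢Y)))) [ (lit p ∷ Γ , G ∷ Δ) ] (lit p ∷ Γ , X ∷ Y ∷ Δ)
    p,Γ⊢X,Y,Δ = sd-cut p,Γ⊢X,Y,Δ≤V
      (sd-perm (refl , rot3 X Y G) (sd-weak-r nX p,Γ⊢X,Y,G,Δ≤V (sd-weak-r nY p,Γ⊢Y,G,Δ≤V (sd-hyp (np ∷ nΓ , nG ∷ nΔ)))))
      (sd-relax G,p,Γ⊢X,Y,Δ≤V (pf-weaken Γ Δ nΓ nΔ (pf-weak-r nX (proof G,p⊢Y))))

  distribute-l : RuleDeriv ((F ∷ Γ , lit p ∷ Δ) ∷ (lit p ∷ G ∷ Γ , Δ) ∷ []) (distribute F p G ∷ Γ , Δ)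
  distribute-l = deriv D , rule2 , ≤-trans (bound D) (quadratic-bound {w = w} nodes≤ V≤4w)
    where
    D : SizedDeriv V _ ((F ∷ Γ , lit p ∷ Δ) ∷ (lit p ∷ G ∷ Γ , Δ) ∷ []) (X ∨ Y ∷ Γ , Δ)
    D = sd-∨-l X∨Y,Γ⊢Δ≤V X,Γ⊢Δ Y,Γ⊢Δ
    nodes≤ : suc (suc (suc (ctx+ (suc (nodes X⊢F)) + 1) + ctx+ (nodes X,p⊢))
               + suc (ctx+ (nodes Y⊢p) + suc (ctx+ (suc (nodes Y⊢G)) + 1))) ≤ 60 * w
    nodes≤ = ≤-trans (m+k≡n⇒m≤n 11 (lemma₁ (nodes X⊢F) (nodes X,p⊢) (nodes Y⊢G) (nodes Y⊢p) (length Γ) (length Δ)))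
      (≤-trans (+-mono-≤ (+-mono-≤ (+-mono-≤ (+-mono-≤ (nodes-bound X⊢F) (nodes-bound X,p⊢))
                                             (+-mono-≤ (nodes-bound Y⊢G) (nodes-bound Y⊢p)))
                                   (*-monoʳ-≤ 4 (proj₁ length≤))) (*-monoʳ-≤ 4 (proj₂ length≤)))
               (m+k≡n⇒m≤n (56 * sG + 56 * sD) (lemma₂ x y sG sD)))
      where lemma₁ : ∀ a b c d lg ld → suc (suc (suc (ld + (lg + suc a) + 1) + (ld + (lg + b)))
                        + suc (ld + (lg + d) + suc (ld + (lg + suc c) + 1))) + 11
                      ≡ (a + 5) + (b + 5) + ((c + 5) + (d + 5)) + 4 * lg + 4 * ld
            lemma₁ = solve-∀
            lemma₂ : ∀ x y sG sD → 30 * x + 30 * x + (30 * y + 30 * y) + 4 * sG + 4 * sD + (56 * sG + 56 * sD)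
                                   ≡ 60 * (x + y + sG + sD)
            lemma₂ = solve-∀

  distribute-r : RuleDeriv ((Γ , F ∷ lit p ∷ Δ) ∷ (lit p ∷ Γ , G ∷ Δ) ∷ []) (Γ , distribute F p G ∷ Δ)
  distribute-r = deriv D , rule1 , ≤-trans (bound D) (≤-trans (quadratic-bound {w = w} nodes≤ V≤4w) (≤-reflexive (cong (λ z → K * (z * z)) w≡)))
    where
    D : SizedDeriv V _ ((Γ , F ∷ lit p ∷ Δ) ∷ (lit p ∷ Γ , G ∷ Δ) ∷ []) (Γ , X ∨ Y ∷ Δ)
    D = sd-∨-r Γ⊢X∨Y,Δ≤V (sd-cut Γ⊢X,Y,Δ≤V (sd-perm (refl , rot3 X Y (lit p)) Γ⊢X,Y,p,Δ) p,Γ⊢X,Y,Δ)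
    w≡ : w ≡ sG + (x + y + sD)
    w≡ = ≡.trans (+-assoc (x + y) sG sD) (≡.trans (cong (x + y +_) (+-comm sG sD))
           (≡.trans (sym (+-assoc (x + y) sD sG)) (+-comm (x + y + sD) sG)))
    nodes≤ : suc (suc (suc (2 + ctx+ (suc (nodes F⊢X,p))) + suc (2 + ctx+ (suc (nodes G,p⊢Y))))) ≤ 60 * w
    nodes≤ = ≤-trans (≤-reflexive (lemma₁ (nodes F⊢X,p) (nodes G,p⊢Y) (length Γ) (length Δ)))
      (≤-trans (+-mono-≤ (+-mono-≤ (+-mono-≤ (nodes-bound F⊢X,p) (nodes-bound G,p⊢Y)) (*-monoʳ-≤ 2 (proj₁ length≤)))
                         (*-monoʳ-≤ 2 (proj₂ length≤)))
               (m+k≡n⇒m≤n (30 * x + 30 * y + 58 * sG + 58 * sD) (lemma₂ x y sG sD)))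
      where lemma₁ : ∀ a b lg ld → suc (suc (suc (2 + (ld + (lg + suc a))) + suc (2 + (ld + (lg + suc b)))))
                                   ≡ (a + 5) + (b + 5) + 2 * lg + 2 * ld
            lemma₁ = solve-∀
            lemma₂ : ∀ x y sG sD → 30 * x + 30 * y + 2 * sG + 2 * sD + (30 * x + 30 * y + 58 * sG + 58 * sD)
                                   ≡ 60 * (x + y + sG + sD)
            lemma₂ = solve-∀

-- Translating proofs

n≤K*n² : ∀ n → n ≤ K * (n * n)
n≤K*n² zero    = z≤n
n≤K*n² (suc n) = ≤-trans (m≤m*n (suc n) (suc n)) (m≤n*m (suc n * suc n) K {{K-nonZero}})

same-rule₀ : ∀ {s} → Inf [] s → SeqNF s → RuleDeriv [] s
same-rule₀ {s} i n = rule0 (step i) n , rule0 , n≤K*n² (ssize s)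

same-rule₁ : ∀ {s₁ s} → Inf [ s₁ ] s → SeqNF s₁ → SeqNF s → RuleDeriv [ s₁ ] s
same-rule₁ {s = s} i n₁ n =
  rule1 (step i) n (hyp ≈S-refl n₁) , rule1 , ≤-trans (≤-reflexive (+-identityʳ (ssize s))) (n≤K*n² (ssize s))

same-rule₂ : ∀ {s₁ s₂ s} → Inf (s₁ ∷ s₂ ∷ []) s → SeqNF s₁ → SeqNF s₂ → SeqNF s → RuleDeriv (s₁ ∷ s₂ ∷ []) s
same-rule₂ {s = s} i n₁ n₂ n =
  rule2 (step i) n (hyp ≈S-refl n₁) (hyp ≈S-refl n₂) , rule2 , ≤-trans (≤-reflexive (+-identityʳ (ssize s))) (n≤K*n² (ssize s))

translate-dec-l : ∀ {Γ Δ F G} p → All IsNF Γ → All IsNF Δ → IsNF F → IsNF G →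
                  RuleDeriv ((F ∷ Γ , lit p ∷ Δ) ∷ (lit p ∷ G ∷ Γ , Δ) ∷ []) (decNF F p G ∷ Γ , Δ)
translate-dec-l p nΓ nΔ nF nG with decNF-view p nF nG
... | kept d e eq rewrite eq =
  same-rule₂ dec-l (dt d ∷ nΓ , dt (lit p) ∷ nΔ) (dt (lit p) ∷ dt e ∷ nΓ , nΔ) (dt (dec p d e) ∷ nΓ , nΔ)
... | distributed eq rewrite eq = Distribution.distribute-l p nΓ nΔ nF nG

translate-dec-r : ∀ {Γ Δ F G} p → All IsNF Γ → All IsNF Δ → IsNF F → IsNF G →
                  RuleDeriv ((Γ , F ∷ lit p ∷ Δ) ∷ (lit p ∷ Γ , G ∷ Δ) ∷ []) (Γ , decNF F p G ∷ Δ)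
translate-dec-r p nΓ nΔ nF nG with decNF-view p nF nG
... | kept d e eq rewrite eq =
  same-rule₂ dec-r (nΓ , dt d ∷ dt (lit p) ∷ nΔ) (dt (lit p) ∷ nΓ , dt e ∷ nΔ) (nΓ , dt (dec p d e) ∷ nΔ)
... | distributed eq rewrite eq = Distribution.distribute-r p nΓ nΔ nF nG

translate-inf : ∀ {ps s} → Inf ps s → RuleDeriv (map nfSeq ps) (nfSeq s)
translate-inf (ax-id p) = same-rule₀ (ax-id p) (dt (lit p) ∷ [] , dt (lit p) ∷ [])
translate-inf (ax-l p)  = same-rule₀ (ax-l p) (dt (lit p) ∷ dt (lit (p ᶜ)) ∷ [] , [])
translate-inf (ax-r p)  = same-rule₀ (ax-r p) ([] , dt (lit p) ∷ dt (lit (p ᶜ)) ∷ [])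
translate-inf (contr-l {Γ} {Δ} {A}) = same-rule₁ contr-l (nfSeq-NF (A ∷ A ∷ Γ , Δ)) (nfSeq-NF (A ∷ Γ , Δ))
translate-inf (contr-r {Γ} {Δ} {A}) = same-rule₁ contr-r (nfSeq-NF (Γ , A ∷ A ∷ Δ)) (nfSeq-NF (Γ , A ∷ Δ))
translate-inf (weak-l {Γ} {Δ} {A})  = same-rule₁ weak-l (nfSeq-NF (Γ , Δ)) (nfSeq-NF (A ∷ Γ , Δ))
translate-inf (weak-r {Γ} {Δ} {A})  = same-rule₁ weak-r (nfSeq-NF (Γ , Δ)) (nfSeq-NF (Γ , A ∷ Δ))
translate-inf (cut {Γ} {Δ} {A})     = same-rule₂ cut (nfSeq-NF (Γ , A ∷ Δ)) (nfSeq-NF (A ∷ Γ , Δ)) (nfSeq-NF (Γ , Δ))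
translate-inf (dec-l {Γ} {Δ} {A} {B} {p}) =
  translate-dec-l p (nfSeq-NF (Γ , Δ) .proj₁) (nfSeq-NF (Γ , Δ) .proj₂) (nf-NF A) (nf-NF B)
translate-inf (dec-r {Γ} {Δ} {A} {B} {p}) =
  translate-dec-r p (nfSeq-NF (Γ , Δ) .proj₁) (nfSeq-NF (Γ , Δ) .proj₂) (nf-NF A) (nf-NF B)
translate-inf (∨-l {Γ} {Δ} {A} {B}) =
  same-rule₂ ∨-l (nfSeq-NF (A ∷ Γ , Δ)) (nfSeq-NF (B ∷ Γ , Δ)) (nfSeq-NF (A ∨ B ∷ Γ , Δ))
translate-inf (∨-r {Γ} {Δ} {A} {B}) = same-rule₁ ∨-r (nfSeq-NF (Γ , A ∷ B ∷ Δ)) (nfSeq-NF (Γ , A ∨ B ∷ Δ))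

blowup : ℕ → ℕ
blowup n = K * n ^ 4

blowup-superadditive : ∀ a b → blowup a + blowup b ≤ blowup (a + b)
blowup-superadditive a b = ≤-trans (≤-reflexive (sym (*-distribˡ-+ K (a ^ 4) (b ^ 4)))) (*-monoʳ-≤ K a⁴+b⁴≤[a+b]⁴)
  where
  a⁴+b⁴≤[a+b]⁴ : a ^ 4 + b ^ 4 ≤ (a + b) ^ 4
  a⁴+b⁴≤[a+b]⁴ = ≤-trans (+-mono-≤ (*-monoʳ-≤ a (^-monoˡ-≤ 3 (m≤m+n a b))) (*-monoʳ-≤ b (^-monoˡ-≤ 3 (m≤n+m b a))))
                        (≤-reflexive (sym (*-distribʳ-+ ((a + b) ^ 3) a b)))

Translates : Seq → Seq → Set
Translates p h = nfSeq p ≈S h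

record TranslatedStep (ps : List Seq) (s : Seq) : Set where
  field
    hyps       : List Seq
    derivation : Deriv hyps (nfSeq s)
    ends       : EndsInRule derivation
    size       : dsize derivation ≤ blowup (ssize s)
    premises   : Pointwise Translates ps hyps

translate-step : ∀ {ps s} → Step ps s → TranslatedStep ps s
translate-step {ps} {s} (ps' , s' , i , pw , e) with translate-inf i
... | d , ends , bound = record
  { hyps       = map nfSeq ps'
  ; derivation = Deriv-resp-≈S e' d
  ; ends       = EndsInRule-resp-≈S e' ends
  ; size       = begin
      dsize (Deriv-resp-≈S e' d)                 ≡⟨ dsize-resp-≈S e' d ⟩
      dsize d                                    ≤⟨ bound ⟩
      K * (ssize (nfSeq s') * ssize (nfSeq s'))  ≤⟨ *-monoʳ-≤ K (*-mono-≤ (nfSeq-size s') (nfSeq-size s')) ⟩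
      K * (ssize s' * ssize s' * (ssize s' * ssize s')) ≡⟨ cong (λ n → K * (n * n * (n * n))) (sym (ssize-≈S e)) ⟩
      K * (ssize s * ssize s * (ssize s * ssize s)) ≡⟨ cong (K *_) (lemma (ssize s)) ⟩
      blowup (ssize s)                           ∎
  ; premises   = translated pw }
  where
  open ≤-Reasoning
  e' : nfSeq s' ≈S nfSeq s
  e' = nfSeq-≈S (≈S-sym e)
  lemma : ∀ n → n * n * (n * n) ≡ n * (n * (n * (n * 1)))
  lemma = solve-∀
  translated : ∀ {qs qs'} → Pointwise _≈S_ qs qs' → Pointwise Translates qs (map nfSeq qs')
  translated []       = []
  translated (q ∷ qs) = nfSeq-≈S q ∷ translated qs

translate-tree : ∀ {s} (t : Tree s) → Σ (Tree (nfSeq s)) λ t' → TreeNF t' × treeSize t' ≤ blowup (treeSize t)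
translate-trees : ∀ {ps hs} (ts : Trees ps) → Pointwise Translates ps hs →
                  Σ (All NFTreeFor hs) λ a → treeSizes a ≤ blowup (treesSize ts)

translate-tree {s} (node st ts) with translate-step st
... | record { derivation = d ; size = d≤ ; premises = pw } with translate-trees ts pw
... | a , a≤ with graft d a
... | t' , nt' , t'≤ = t' , nt' , ≤-trans t'≤ (≤-trans (+-mono-≤ d≤ a≤) (blowup-superadditive (ssize s) (treesSize ts)))

translate-trees []       []       = [] , z≤n
translate-trees (t ∷ ts) (e ∷ pw) with translate-tree t | translate-trees ts pw
... | t' , nt' , t'≤ | a , a≤ =
  (_ , e , t' , nt') ∷ a , ≤-trans (+-mono-≤ t'≤ a≤) (blowup-superadditive (treeSize t) (treesSize ts))

tree-normalisation : ∀ S → SeqNF S → (π : Tree S) →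
                     Σ (Tree S) λ π' → TreeNF π' × treeSize π' ≤ K * treeSize π ^ 4 + K
tree-normalisation S nS π with nfSeq S | nfSeq-id nS | translate-tree π
... | _ | refl | π' , nπ' , π'≤ = π' , nπ' , ≤-trans π'≤ (m≤m+n _ K)

StartsWith : List Seq → List Seq → Set
StartsWith []      _   = ⊤
StartsWith (s ∷ _) ls' = Σ (List Seq) λ rest → ls' ≡ nfSeq s ∷ rest

record TranslatedLines (ls : List Seq) : Set where
  field
    ls'      : List Seq
    lines    : Lines ls'
    lines-NF : All SeqNF ls'
    member   : ∀ {h} → h ∈ ls → nfSeq h ∈ ls'
    size     : dagSize ls' ≤ blowup (dagSize ls)
    head     : StartsWith ls ls'

premise-lines : ∀ {ls ls' ps hs} → (∀ {h} → h ∈ ls → nfSeq h ∈ ls') →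
                All (_∈ ls) ps → Pointwise Translates ps hs → All (LineFor ls') hs
premise-lines member []       []       = []
premise-lines member (m ∷ ms) (e ∷ pw) = (_ , member m , e) ∷ premise-lines member ms pw

translate-lines : ∀ {ls} → Lines ls → TranslatedLines ls
translate-lines [] = record { ls' = [] ; lines = [] ; lines-NF = [] ; member = λ () ; size = z≤n ; head = tt }
translate-lines {s ∷ ls} ((ps , ms , st) ∷ L) with translate-lines L
... | record { ls' = ls₁ ; lines = L₁ ; lines-NF = nf₁ ; member = mem₁ ; size = sz₁ } with translate-step st
... | record { derivation = d ; ends = ends ; size = d≤ ; premises = pw } with emit d L₁ (premise-lines mem₁ ms pw)
... | record { new = new ; lines = L' ; new-NF = nf' ; new-size = sz' ; last = last } with last ends
... | rest , refl = record
  { ls'      = nfSeq s ∷ rest ++ ls₁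
  ; lines    = L'
  ; lines-NF = ++⁺ nf' nf₁
  ; member   = λ { (here refl) → here refl ; (there m) → ∈-++⁺ʳ (nfSeq s ∷ rest) (mem₁ m) }
  ; size     = ≤-trans (≤-reflexive (dagSize-++ (nfSeq s ∷ rest) ls₁))
                 (≤-trans (+-mono-≤ (≤-trans sz' d≤) sz₁) (blowup-superadditive (ssize s) (dagSize ls)))
  ; head     = rest ++ ls₁ , refl }

dag-normalisation : ∀ S → SeqNF S → ∀ earlier → DagProof S earlier →
                    ∃[ earlier' ] Σ (DagProof S earlier') λ _ → DagNF (S ∷ earlier')
                      × dagSize (S ∷ earlier') ≤ K * dagSize (S ∷ earlier) ^ 4 + K
dag-normalisation S nS earlier π with translate-lines π
... | record { ls' = ls' ; lines = L ; lines-NF = nf ; size = sz ; head = rest , eq } =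
  rest , subst Lines ls'≡ L , subst (All SeqNF) ls'≡ nf , subst (λ ls → dagSize ls ≤ _) ls'≡ (≤-trans sz (m≤m+n _ K))
  where
  ls'≡ : ls' ≡ S ∷ rest
  ls'≡ = ≡.trans eq (cong (_∷ rest) (nfSeq-id nS))

theorem4p6 :
    (∃[ c ] ∃[ k ] ∀ (S : Seq) → SeqNF S → ∀ (earlier : List Seq) → DagProof S earlier →
        ∃[ earlier' ] Σ (DagProof S earlier') λ _ → DagNF (S ∷ earlier')
          × dagSize (S ∷ earlier') ≤ c * dagSize (S ∷ earlier) ^ k + c)
    × (∃[ c ] ∃[ k ] ∀ (S : Seq) → SeqNF S → (π : Tree S) →
        Σ (Tree S) λ π' → TreeNF π' × treeSize π' ≤ c * treeSize π ^ k + c)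
theorem4p6 = (K , 4 , dag-normalisation) , (K , 4 , tree-normalisation)
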